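{- Let $\sigma$ be a partition of a positive integer $r$, let $n,q$ be positive integers, let $H=H(n,r,q\mid\sigma)$ and write $s=s(\sigma)$. Let $\alpha,\beta$ be integers with $2\le \alpha \leq s \leq \beta$, and write $\beta = sk+t$ with integers $k \geq 1$ and $0 \leq t \leq s-1$. Then the $(\alpha,\beta)$-spectrum of $H$ contains every integer $m$ with \[ \left\lceil \frac{ n-\left(s-1- (\alpha -1) \left\lfloor \frac{s-1}{\alpha -1} \right\rfloor\right) }{ \left\lfloor \frac{s - 1}{\alpha - 1} \right\rfloor} \right\rceil \leq m \leq \min \{nq,\ nk + \beta -ks\}. \]
   Context: For a partition $\sigma$ of $r$ and positive integers $n,q$, the $\sigma$-hypergraph $H(n,r,q\mid\sigma)$ is the $r$-uniform hypergraph whose vertex set has $nq$ vertices partitioned into $n$ classes $V_1,\dots,V_n$ of $q$ vertices each, and in which an $r$-subset $K$ of the vertex set is an edge if and only if the multiset of non-zero cardinalities $|K\cap V_i|$, $1\le i\le n$, is exactly the partition $\sigma$. $s(\sigma)$ denotes the number of parts of $\sigma$. For integers $\alpha\le\beta$, an $(\alpha,\beta)$-colouring of a hypergraph is an assignment of colours to its vertices such that every edge contains at least $\alpha$ and at most $\beta$ distinct colours; a $k$-$(\alpha,\beta)$-colouring is one using exactly $k$ colours. The $(\alpha,\beta)$-spectrum of $H$ is the set of all $k$ for which $H$ has a $k$-$(\alpha,\beta)$-colouring. -}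

module Defs where

open import Data.Nat using (ℕ; zero; suc; _+_; _*_; _∸_; _≤_; _<_)
open import Data.Nat.DivMod using (_/_)
open import Data.Bool using (Bool; true; false; _∧_)
open import Data.Fin using (Fin; _≟_)
open import Data.Fin.Subset using (Subset; ∣_∣)
open import Data.Vec using (lookup; tabulate)
open import Data.List using (List; length; map; allFin; filterᵇ)
open import Data.Nat.ListAction using (sum)
open import Data.Bool.ListAction using (any)
open import Data.List.Relation.Unary.All using (All)
open import Data.List.Relation.Binary.Permutation.Propositional using (_↭_)
open import Data.Product using (Σ; ∃; _×_; _,_)
open import Relation.Binary.PropositionalEquality using (_≡_)
open import Relation.Nullary.Decidable using (⌊_⌋)

-- A partition of r: a list of positive parts summing to r (order irrelevant;
-- all uses below are up to permutation).
IsPartition : ℕ → List ℕ → Set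
IsPartition r σ = All (λ x → 1 ≤ x) σ × sum σ ≡ r

s : List ℕ → ℕ
s σ = length σ

-- Vertices of H(n,r,q|σ): pairs (i , x) with i : Fin n the class V_i and
-- x : Fin q the position inside V_i.  A vertex subset K is given by its
-- traces K i ⊆ V_i.
VSubset : ℕ → ℕ → Set
VSubset n q = Fin n → Subset q

nonzero? : ℕ → Bool
nonzero? zero = false
nonzero? (suc _) = true

classSizes : ∀ {n q} → VSubset n q → List ℕ
classSizes {n} K = filterᵇ nonzero? (map (λ i → ∣ K i ∣) (allFin n))

-- K is an edge of H(n,r,q|σ).  (|K| = r follows since the parts sum to r.)
IsEdge : (n r q : ℕ) (σ : List ℕ) → VSubset n q → Set
IsEdge n r q σ K = classSizes K ↭ σ

Colouring : ℕ → ℕ → ℕ → Set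
Colouring n q m = Fin n → Fin q → Fin m

coloursOn : ∀ {n q m} → Colouring n q m → VSubset n q → Subset m
coloursOn {n} {q} c K =
  tabulate (λ j → any (λ i → any (λ x → lookup (K i) x ∧ ⌊ c i x ≟ j ⌋) (allFin q)) (allFin n))

numColours : ∀ {n q m} → Colouring n q m → VSubset n q → ℕ
numColours c K = ∣ coloursOn c K ∣

Surjective : ∀ {n q m} → Colouring n q m → Set
Surjective {n} {q} {m} c = (j : Fin m) → Σ (Fin n) λ i → Σ (Fin q) λ x → c i x ≡ j

IsColouringαβ : (n r q : ℕ) (σ : List ℕ) (α β : ℕ) {m : ℕ} → Colouring n q m → Set
IsColouringαβ n r q σ α β c =
  Surjective c ×
  ((K : VSubset n q) → IsEdge n r q σ K → α ≤ numColours c K × numColours c K ≤ β)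

InSpectrum : (n r q : ℕ) (σ : List ℕ) (α β m : ℕ) → Set
InSpectrum n r q σ α β m = Σ (Colouring n q m) λ c → IsColouringαβ n r q σ α β c

-- floor division (divisor assumed nonzero where used; 0 for divisor 0)
divℕ : ℕ → ℕ → ℕ
divℕ a zero = 0
divℕ a (suc b) = a / suc b

ceilDiv : ℕ → ℕ → ℕ
ceilDiv a b = divℕ (a + b ∸ 1) b

-- Write a = α − 1, d = ⌊(s − 1)/a⌋ and ρ = s − 1 − a d, so that s = ρ + a d + 1 and the
-- lower bound on m says n − ρ ≤ m d.
-- If m ≥ n, colour vertex x of class i by x n + i when this is below m and by i otherwise.
-- Every colour is then congruent to its class mod n, so an edge, which meets s classes,
-- sees at least s ≥ α colours, and since m ≤ n k + t it sees at most s k + t = β.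
-- If m < n, give every vertex of class i the colour (i ∸ ρ′) mod m, where ρ′ = min(ρ, n − m).
-- An edge then sees at most s ≤ β colours, and as n − ρ′ ≤ m d, each colour is shared by at
-- most d classes beyond the first ρ′; so an edge seeing C colours meets at most ρ + C d
-- classes, which forces C > a.
module Submission where

open import Defs
open import Data.Nat
  using (ℕ; zero; suc; _+_; _*_; _∸_; _≤_; _<_; _⊓_; _⊔_; z≤n; s≤s; s≤s⁻¹; NonZero; >-nonZero)
open import Data.Nat.Properties hiding (_≟_)
open import Data.Nat.DivMod
open import Data.Bool using (Bool; true; false; T; _∧_)
open import Data.Bool.Properties using (T-≡; T-∧)
open import Data.Bool.ListAction using (any)
open import Data.Fin using (Fin; zero; suc; toℕ; fromℕ<; _↑ˡ_; _↑ʳ_; splitAt; combine; remQuot; _≟_)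
open import Data.Fin.Properties
  using (toℕ<n; toℕ-injective; toℕ-fromℕ<; fromℕ<-injective; injective⇒≤; ↑ˡ-injective; ↑ʳ-injective;
         splitAt-↑ˡ; splitAt-↑ʳ; combine-injective; remQuot-combine)
open import Data.Fin.Subset using (Subset; inside; outside; _∈_; Nonempty; ∣_∣)
open import Data.Fin.Subset.Properties using (∣p∣≤n)
open import Data.Vec using (_∷_; here; there; lookup; tabulate)
open import Data.Vec.Properties using (lookup∘tabulate; []=⇒lookup; lookup⇒[]=)
open import Data.List using (List; allFin; filterᵇ; length)
import Data.List as List
open import Data.List.Properties using (map-tabulate)
open import Data.List.Relation.Unary.Any using (satisfied)
open import Data.List.Relation.Unary.Any.Properties using (any⁺; any⁻)
open import Data.List.Membership.Propositional using (lose)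
open import Data.List.Membership.Propositional.Properties using (∈-allFin)
open import Data.List.Relation.Binary.Permutation.Propositional using (_↭_)
open import Data.List.Relation.Binary.Permutation.Propositional.Properties using (↭-length)
open import Data.Product using (∃; ∃₂; _×_; _,_; proj₁; proj₂; uncurry)
open import Data.Sum using ([_,_])
open import Data.Unit using (tt)
open import Data.Empty using (⊥-elim)
open import Function using (_∘_; Equivalence)
open import Function.Definitions using (Injective)
open import Relation.Binary.PropositionalEquality hiding ([_])
open import Relation.Nullary using (yes; no)
open import Relation.Nullary.Decidable using (⌊_⌋; toWitness; fromWitness)

private variable
  a n m q : ℕ
  p p′ : Subset n
  i x : Fin n

enum : (p : Subset n) → Fin ∣ p ∣ → Fin n
enum (inside ∷ p) zero = zero
enum (inside ∷ p) (suc u) = suc (enum p u)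
enum (outside ∷ p) u = suc (enum p u)

enum-∈ : (p : Subset n) (u : Fin ∣ p ∣) → enum p u ∈ p
enum-∈ (inside ∷ p) zero = here
enum-∈ (inside ∷ p) (suc u) = there (enum-∈ p u)
enum-∈ (outside ∷ p) u = there (enum-∈ p u)

enum-injective : (p : Subset n) → Injective _≡_ _≡_ (enum p)
enum-injective (inside ∷ p) {zero} {zero} _ = refl
enum-injective (inside ∷ p) {suc u} {suc v} eq =
  cong suc (enum-injective p (Data.Fin.Properties.suc-injective eq))
enum-injective (outside ∷ p) eq = enum-injective p (Data.Fin.Properties.suc-injective eq)

index : x ∈ p → Fin ∣ p ∣
index {p = inside ∷ p} here = zero
index {p = inside ∷ p} (there x∈p) = suc (index x∈p)
index {p = outside ∷ p} (there x∈p) = index x∈p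

enum-index : (x∈p : x ∈ p) → enum p (index x∈p) ≡ x
enum-index {p = inside ∷ p} here = refl
enum-index {p = inside ∷ p} (there x∈p) = cong suc (enum-index x∈p)
enum-index {p = outside ∷ p} (there x∈p) = cong suc (enum-index x∈p)

index-injective : ∀ {x y} (x∈p : x ∈ p) (y∈p : y ∈ p) → index x∈p ≡ index y∈p → x ≡ y
index-injective {p = p} x∈p y∈p eq =
  trans (sym (enum-index x∈p)) (trans (cong (enum p) eq) (enum-index y∈p))

injection⇒∣p∣≤ : (φ : ∀ {x} → x ∈ p → Fin a) →
  (∀ {x y} (x∈p : x ∈ p) (y∈p : y ∈ p) → φ x∈p ≡ φ y∈p → x ≡ y) → ∣ p ∣ ≤ a
injection⇒∣p∣≤ {p = p} φ φ-inj =
  injective⇒≤ λ {u} {v} eq → enum-injective p (φ-inj (enum-∈ p u) (enum-∈ p v) eq)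

injection⇒∣p∣≤∣p′∣ : (φ : ∀ {x} → x ∈ p → Fin m) → (∀ {x} (x∈p : x ∈ p) → φ x∈p ∈ p′) →
  (∀ {x y} (x∈p : x ∈ p) (y∈p : y ∈ p) → φ x∈p ≡ φ y∈p → x ≡ y) → ∣ p ∣ ≤ ∣ p′ ∣
injection⇒∣p∣≤∣p′∣ φ φ∈p′ φ-inj = injection⇒∣p∣≤ (index ∘ φ∈p′) λ x∈p y∈p eq →
  φ-inj x∈p y∈p (index-injective (φ∈p′ x∈p) (φ∈p′ y∈p) eq)

cover⇒∣p∣≤ : (g : Fin a → ℕ) → (∀ {x} → x ∈ p → ∃ λ u → g u ≡ toℕ x) → ∣ p ∣ ≤ a
cover⇒∣p∣≤ g cover = injection⇒∣p∣≤ (proj₁ ∘ cover) λ x∈p y∈p eq →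
  toℕ-injective (trans (sym (proj₂ (cover x∈p))) (trans (cong g eq) (proj₂ (cover y∈p))))

y*n+i<n*k+t⇒y≡k×i<t : ∀ {n k t y i} → t ≤ n → y * n + i < n * k + t → k ≤ y → y ≡ k × i < t
y*n+i<n*k+t⇒y≡k×i<t {n} {k} {t} {y} {i} t≤n lt k≤y = ≤-antisym y≤k k≤y , i<t
  where
  open ≤-Reasoning
  i<t : i < t
  i<t = +-cancelˡ-< (n * k) i t (begin-strict
    n * k + i  ≡⟨ cong (_+ i) (*-comm n k) ⟩
    k * n + i  ≤⟨ +-monoˡ-≤ i (*-monoˡ-≤ n k≤y) ⟩
    y * n + i  <⟨ lt ⟩
    n * k + t  ∎)
  y≤k : y ≤ k
  y≤k = ≮⇒≥ λ k<y → <-irrefl refl (begin-strict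
    n * k + t    ≤⟨ +-monoʳ-≤ (n * k) t≤n ⟩
    n * k + n    ≡⟨ trans (+-comm (n * k) n) (cong (n +_) (*-comm n k)) ⟩
    suc k * n    ≤⟨ *-monoˡ-≤ n k<y ⟩
    y * n        ≤⟨ m≤m+n (y * n) i ⟩
    y * n + i    <⟨ lt ⟩
    n * k + t    ∎)

∣p∣≤∣p′∣*k+t : ∀ {p : Subset m} {p′ : Subset n} k t → m ≤ n * k + t → t ≤ n →
  (∀ {j} → j ∈ p → ∃₂ λ y i → i ∈ p′ × toℕ j ≡ y * n + toℕ i) → ∣ p ∣ ≤ ∣ p′ ∣ * k + t
∣p∣≤∣p′∣*k+t {m} {n} {p} {p′} k t m≤n*k+t t≤n form = cover⇒∣p∣≤ g cover
  where
  row : Fin ∣ p′ ∣ → Fin k → ℕ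
  row u y = toℕ y * n + toℕ (enum p′ u)
  -- The first ∣ p′ ∣ * k codes name y n + i with i ∈ p′ and y < k, the last t name k n + i with i < t.
  g : Fin (∣ p′ ∣ * k + t) → ℕ
  g w = [ uncurry row ∘ remQuot k , (λ i → k * n + toℕ i) ] (splitAt (∣ p′ ∣ * k) w)
  cover : ∀ {j} → j ∈ p → ∃ λ w → g w ≡ toℕ j
  cover {j} j∈p with form j∈p
  ... | y , i , i∈p′ , j≡ with y <? k
  ... | yes y<k = combine (index i∈p′) (fromℕ< y<k) ↑ˡ t , (begin
    g (combine (index i∈p′) (fromℕ< y<k) ↑ˡ t)
      ≡⟨ cong [ _ , _ ] (splitAt-↑ˡ (∣ p′ ∣ * k) _ t) ⟩
    uncurry row (remQuot k (combine (index i∈p′) (fromℕ< y<k)))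
      ≡⟨ cong (uncurry row) (remQuot-combine (index i∈p′) _) ⟩
    toℕ (fromℕ< y<k) * n + toℕ (enum p′ (index i∈p′))
      ≡⟨ cong₂ (λ y i → y * n + toℕ i) (toℕ-fromℕ< y<k) (enum-index i∈p′) ⟩
    y * n + toℕ i
      ≡⟨ sym j≡ ⟩
    toℕ j ∎)
    where open ≡-Reasoning
  ... | no y≮k
    with y*n+i<n*k+t⇒y≡k×i<t t≤n (subst (_< n * k + t) j≡ (<-≤-trans (toℕ<n j) m≤n*k+t)) (≮⇒≥ y≮k)
  ...   | refl , i<t = ∣ p′ ∣ * k ↑ʳ fromℕ< i<t , (begin
    g (∣ p′ ∣ * k ↑ʳ fromℕ< i<t)  ≡⟨ cong [ _ , _ ] (splitAt-↑ʳ (∣ p′ ∣ * k) t _) ⟩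
    y * n + toℕ (fromℕ< i<t)     ≡⟨ cong (y * n +_) (toℕ-fromℕ< i<t) ⟩
    y * n + toℕ i                ≡⟨ sym j≡ ⟩
    toℕ j                        ∎)
    where open ≡-Reasoning

∣p∣≤e+∣p′∣*d : ∀ {p : Subset n} {p′ : Subset m} e d (κ : Fin n → Fin m) (ℓ : Fin n → ℕ) →
  (∀ {i} → i ∈ p → κ i ∈ p′) → (∀ i → e ≤ toℕ i → ℓ i < d) →
  (∀ {i j} → e ≤ toℕ i → e ≤ toℕ j → κ i ≡ κ j → ℓ i ≡ ℓ j → i ≡ j) →
  ∣ p ∣ ≤ e + ∣ p′ ∣ * d
∣p∣≤e+∣p′∣*d {p′ = p′} e d κ ℓ κ∈p′ ℓ<d κℓ-inj = injection⇒∣p∣≤ φ φ-inj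
  where
  φ : ∀ {i} → i ∈ _ → Fin (e + ∣ p′ ∣ * d)
  φ {i} i∈p with toℕ i <? e
  ... | yes i<e = fromℕ< i<e ↑ˡ ∣ p′ ∣ * d
  ... | no i≮e = e ↑ʳ combine (index (κ∈p′ i∈p)) (fromℕ< (ℓ<d i (≮⇒≥ i≮e)))

  φ-inj : ∀ {i j} (i∈p : i ∈ _) (j∈p : j ∈ _) → φ i∈p ≡ φ j∈p → i ≡ j
  φ-inj {i} {j} i∈p j∈p eq with toℕ i <? e | toℕ j <? e
  ... | yes i<e | yes j<e = toℕ-injective (fromℕ<-injective _ _ i<e j<e (↑ˡ-injective _ _ _ eq))
  ... | yes _ | no _
    with () ← trans (sym (splitAt-↑ˡ e _ _)) (trans (cong (splitAt e) eq) (splitAt-↑ʳ e _ _))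
  ... | no _ | yes _
    with () ← trans (sym (splitAt-↑ʳ e _ _)) (trans (cong (splitAt e) eq) (splitAt-↑ˡ e _ _))
  ... | no i≮e | no j≮e with combine-injective _ _ _ _ (↑ʳ-injective e _ _ eq)
  ...   | same-colour , same-level = κℓ-inj (≮⇒≥ i≮e) (≮⇒≥ j≮e)
          (index-injective (κ∈p′ i∈p) (κ∈p′ j∈p) same-colour) (fromℕ<-injective _ _ _ _ same-level)

∈-tabulate⁺ : ∀ {f : Fin n → Bool} → T (f i) → i ∈ tabulate f
∈-tabulate⁺ {i = i} {f} fi =
  lookup⇒[]= i (tabulate f) (trans (lookup∘tabulate f i) (Equivalence.to T-≡ fi))

∈-tabulate⁻ : ∀ {f : Fin n → Bool} → i ∈ tabulate f → T (f i)
∈-tabulate⁻ {i = i} {f} i∈ =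
  Equivalence.from T-≡ (trans (sym (lookup∘tabulate f i)) ([]=⇒lookup i∈))

∈⇒T-lookup : x ∈ p → T (lookup p x)
∈⇒T-lookup x∈p = Equivalence.from T-≡ ([]=⇒lookup x∈p)

T-lookup⇒∈ : T (lookup p x) → x ∈ p
T-lookup⇒∈ {p = p} {x} t = lookup⇒[]= x p (Equivalence.to T-≡ t)

nonzero?∣p∣⁺ : x ∈ p → T (nonzero? ∣ p ∣)
nonzero?∣p∣⁺ {p = inside ∷ p} _ = tt
nonzero?∣p∣⁺ {p = outside ∷ p} (there x∈p) = nonzero?∣p∣⁺ x∈p

nonzero?∣p∣⁻ : T (nonzero? ∣ p ∣) → Nonempty p
nonzero?∣p∣⁻ {p = inside ∷ p} _ = zero , here
nonzero?∣p∣⁻ {p = outside ∷ p} t with nonzero?∣p∣⁻ {p = p} t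
... | x , x∈p = suc x , there x∈p

length-filterᵇ-tabulate : ∀ {A : Set} (b : A → Bool) (h : Fin n → A) →
  length (filterᵇ b (List.tabulate h)) ≡ ∣ tabulate (b ∘ h) ∣
length-filterᵇ-tabulate {zero} b h = refl
length-filterᵇ-tabulate {suc n} b h with b (h zero)
... | true = cong suc (length-filterᵇ-tabulate b (h ∘ suc))
... | false = length-filterᵇ-tabulate b (h ∘ suc)

touched : VSubset n q → Subset n
touched K = tabulate (λ i → nonzero? ∣ K i ∣)

∈-touched⁺ : (K : VSubset n q) → x ∈ K i → i ∈ touched K
∈-touched⁺ K x∈Ki = ∈-tabulate⁺ (nonzero?∣p∣⁺ x∈Ki)

∈-touched⁻ : (K : VSubset n q) → i ∈ touched K → Nonempty (K i)
∈-touched⁻ K i∈T = nonzero?∣p∣⁻ (∈-tabulate⁻ i∈T)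

∣touched∣≡s : ∀ {σ} (K : VSubset n q) → classSizes K ↭ σ → ∣ touched K ∣ ≡ s σ
∣touched∣≡s {σ = σ} K edge = begin
  ∣ touched K ∣
    ≡⟨ length-filterᵇ-tabulate nonzero? (λ i → ∣ K i ∣) ⟨
  length (filterᵇ nonzero? (List.tabulate (λ i → ∣ K i ∣)))
    ≡⟨ cong (length ∘ filterᵇ nonzero?) (map-tabulate (λ i → i) (λ i → ∣ K i ∣)) ⟨
  length (classSizes K)
    ≡⟨ ↭-length edge ⟩
  s σ ∎
  where open ≡-Reasoning

∈-coloursOn⁺ : (c : Colouring n q m) (K : VSubset n q) {i : Fin n} {x : Fin q} →
  x ∈ K i → c i x ∈ coloursOn c K
∈-coloursOn⁺ {q = q} c K {i} {x} x∈Ki =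
  ∈-tabulate⁺ (any⁺ (λ i′ → any (hasColour (c i x) i′) (allFin q)) (lose (∈-allFin i)
    (any⁺ (hasColour (c i x) i) (lose (∈-allFin x)
      (Equivalence.from T-∧ (∈⇒T-lookup x∈Ki , fromWitness refl))))))
  where
  hasColour : Fin _ → (i : Fin _) → Fin q → Bool
  hasColour j i x = lookup (K i) x ∧ ⌊ c i x ≟ j ⌋

∈-coloursOn⁻ : (c : Colouring n q m) (K : VSubset n q) {j : Fin m} → j ∈ coloursOn c K →
  ∃₂ λ i x → x ∈ K i × c i x ≡ j
∈-coloursOn⁻ {n} {q} c K j∈ with satisfied (any⁻ _ (allFin n) (∈-tabulate⁻ j∈))
... | i , t with satisfied (any⁻ _ (allFin q) t)
... | x , t′ with Equivalence.to T-∧ t′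
... | x∈Ki , cix≡j = i , x , T-lookup⇒∈ x∈Ki , toWitness cix≡j

∣touched∣≤numColours : (c : Colouring n q m) → (∀ {i i′ x x′} → c i x ≡ c i′ x′ → i ≡ i′) →
  (K : VSubset n q) → ∣ touched K ∣ ≤ numColours c K
∣touched∣≤numColours c c-determines-class K =
  injection⇒∣p∣≤∣p′∣ (λ i∈T → c _ (proj₁ (∈-touched⁻ K i∈T)))
    (λ i∈T → ∈-coloursOn⁺ c K (proj₂ (∈-touched⁻ K i∈T))) (λ _ _ → c-determines-class)

numColours≤∣touched∣ : (κ : Fin n → Fin m) (K : VSubset n q) →
  numColours (λ i _ → κ i) K ≤ ∣ touched K ∣
numColours≤∣touched∣ κ K =
  injection⇒∣p∣≤∣p′∣ (proj₁ ∘ source) (λ j∈C → ∈-touched⁺ K (proj₁ (proj₂ (proj₂ (source j∈C)))))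
    λ j∈C j′∈C same-class → trans (sym (colour j∈C)) (trans (cong κ same-class) (colour j′∈C))
  where
  source : ∀ {j} → j ∈ coloursOn (λ i _ → κ i) K → ∃₂ λ i x → x ∈ K i × κ i ≡ j
  source = ∈-coloursOn⁻ (λ i _ → κ i) K
  colour : ∀ {j} (j∈C : j ∈ coloursOn (λ i _ → κ i) K) → κ (proj₁ (source j∈C)) ≡ j
  colour j∈C = proj₂ (proj₂ (proj₂ (source j∈C)))

module ResidueColouring (n q m : ℕ) .{{_ : NonZero n}} (n≤m : n ≤ m) (m≤n*q : m ≤ n * q) where

  row : ℕ → ℕ → ℕ
  row i x with x * n + i <? m
  ... | yes _ = x
  ... | no _ = 0

  row*n+i<m : ∀ i → i < n → ∀ x → row i x * n + i < m
  row*n+i<m i i<n x with x * n + i <? m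
  ... | yes lt = lt
  ... | no _ = <-≤-trans i<n n≤m

  row-inside : ∀ i x → x * n + i < m → row i x ≡ x
  row-inside i x lt with x * n + i <? m
  ... | yes _ = refl
  ... | no ≮ = ⊥-elim (≮ lt)

  colour : Colouring n q m
  colour i x = fromℕ< (row*n+i<m (toℕ i) (toℕ<n i) (toℕ x))

  toℕ-colour : ∀ i x → toℕ (colour i x) ≡ row (toℕ i) (toℕ x) * n + toℕ i
  toℕ-colour i x = toℕ-fromℕ< _

  toℕ-colour%n : ∀ i x → toℕ (colour i x) % n ≡ toℕ i
  toℕ-colour%n i x = begin
    toℕ (colour i x) % n                  ≡⟨ cong (_% n) (trans (toℕ-colour i x) (+-comm _ (toℕ i))) ⟩
    (toℕ i + row (toℕ i) (toℕ x) * n) % n ≡⟨ [m+kn]%n≡m%n (toℕ i) (row (toℕ i) (toℕ x)) n ⟩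
    toℕ i % n                             ≡⟨ m<n⇒m%n≡m (toℕ<n i) ⟩
    toℕ i                                 ∎
    where open ≡-Reasoning

  colour-determines-class : ∀ {i i′ x x′} → colour i x ≡ colour i′ x′ → i ≡ i′
  colour-determines-class {i} {i′} {x} {x′} eq = toℕ-injective
    (trans (sym (toℕ-colour%n i x)) (trans (cong (λ j → toℕ j % n) eq) (toℕ-colour%n i′ x′)))

  colour-surjective : Surjective colour
  colour-surjective j = class , vertex , toℕ-injective (begin
    toℕ (colour class vertex)
      ≡⟨ toℕ-colour class vertex ⟩
    row (toℕ class) (toℕ vertex) * n + toℕ class
      ≡⟨ cong₂ (λ i x → row i x * n + i) (toℕ-fromℕ< _) (toℕ-fromℕ< _) ⟩
    row (toℕ j % n) (toℕ j / n) * n + toℕ j % n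
      ≡⟨ cong (λ y → y * n + toℕ j % n) (row-inside _ _ j<m) ⟩
    toℕ j / n * n + toℕ j % n
      ≡⟨ j≡[j/n]*n+j%n ⟨
    toℕ j ∎)
    where
    open ≡-Reasoning
    j≡[j/n]*n+j%n : toℕ j ≡ toℕ j / n * n + toℕ j % n
    j≡[j/n]*n+j%n = trans (m≡m%n+[m/n]*n (toℕ j) n) (+-comm (toℕ j % n) _)
    j<m : toℕ j / n * n + toℕ j % n < m
    j<m = subst (_< m) j≡[j/n]*n+j%n (toℕ<n j)
    class : Fin n
    class = fromℕ< (m%n<n (toℕ j) n)
    vertex : Fin q
    vertex = fromℕ< (m<n*o⇒m/o<n (<-≤-trans (toℕ<n j) (subst (m ≤_) (*-comm n q) m≤n*q)))

  numColours≤∣touched∣*k+t : ∀ k t → m ≤ n * k + t → t ≤ n →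
    (K : VSubset n q) → numColours colour K ≤ ∣ touched K ∣ * k + t
  numColours≤∣touched∣*k+t k t m≤n*k+t t≤n K = ∣p∣≤∣p′∣*k+t k t m≤n*k+t t≤n λ j∈C →
    let i , x , x∈Ki , colour≡j = ∈-coloursOn⁻ colour K j∈C
    in row (toℕ i) (toℕ x) , i , ∈-touched⁺ K x∈Ki ,
       trans (cong toℕ (sym colour≡j)) (toℕ-colour i x)

module CyclicClassColouring (n q m ρ d : ℕ) .{{_ : NonZero m}}
  (m<n : m < n) (1≤d : 1 ≤ d) (n∸ρ≤m*d : n ∸ ρ ≤ m * d) where

  -- Capping the offset at n − m leaves m classes after it, so that every colour occurs.
  offset : ℕ
  offset = ρ ⊓ (n ∸ m)

  n∸offset≤m*d : n ∸ offset ≤ m * d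
  n∸offset≤m*d = begin
    n ∸ (ρ ⊓ (n ∸ m))          ≡⟨ ∸-distribˡ-⊓-⊔ n ρ (n ∸ m) ⟩
    (n ∸ ρ) ⊔ (n ∸ (n ∸ m))    ≡⟨ cong ((n ∸ ρ) ⊔_) (m∸[m∸n]≡n (<⇒≤ m<n)) ⟩
    (n ∸ ρ) ⊔ m                ≤⟨ ⊔-lub n∸ρ≤m*d (subst (_≤ m * d) (*-identityʳ m) (*-monoʳ-≤ m 1≤d)) ⟩
    m * d                      ∎
    where open ≤-Reasoning

  classColour : Fin n → Fin m
  classColour i = fromℕ< (m%n<n (toℕ i ∸ offset) m)

  level : Fin n → ℕ
  level i = (toℕ i ∸ offset) / m

  colour : Colouring n q m
  colour i _ = classColour i

  colour-surjective : Fin q → Surjective colour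
  colour-surjective x j = class , x , toℕ-injective (begin
    toℕ (classColour class)           ≡⟨ toℕ-fromℕ< _ ⟩
    (toℕ class ∸ offset) % m          ≡⟨ cong (λ i → (i ∸ offset) % m) (toℕ-fromℕ< j+offset<n) ⟩
    (toℕ j + offset ∸ offset) % m     ≡⟨ cong (_% m) (m+n∸n≡m (toℕ j) offset) ⟩
    toℕ j % m                         ≡⟨ m<n⇒m%n≡m (toℕ<n j) ⟩
    toℕ j                             ∎)
    where
    open ≡-Reasoning
    j+offset<n : toℕ j + offset < n
    j+offset<n = subst (toℕ j + offset <_) (m+[n∸m]≡n (<⇒≤ m<n))
      (+-mono-<-≤ (toℕ<n j) (m⊓n≤n ρ (n ∸ m)))
    class : Fin n
    class = fromℕ< j+offset<n

  level<d : ∀ i → offset ≤ toℕ i → level i < d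
  level<d i offset≤i = m<n*o⇒m/o<n (subst (toℕ i ∸ offset <_) (*-comm m d)
    (<-≤-trans (∸-monoˡ-< (toℕ<n i) offset≤i) n∸offset≤m*d))

  classColour-level-injective : ∀ {i i′} → offset ≤ toℕ i → offset ≤ toℕ i′ →
    classColour i ≡ classColour i′ → level i ≡ level i′ → i ≡ i′
  classColour-level-injective {i} {i′} offset≤i offset≤i′ same-colour same-level =
    toℕ-injective (∸-cancelʳ-≡ offset≤i offset≤i′ (begin
      toℕ i ∸ offset
        ≡⟨ m≡m%n+[m/n]*n (toℕ i ∸ offset) m ⟩
      (toℕ i ∸ offset) % m + level i * m
        ≡⟨ cong₂ (λ r l → r + l * m) (fromℕ<-injective _ _ _ _ same-colour) same-level ⟩
      (toℕ i′ ∸ offset) % m + level i′ * m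
        ≡⟨ m≡m%n+[m/n]*n (toℕ i′ ∸ offset) m ⟨
      toℕ i′ ∸ offset ∎))
    where open ≡-Reasoning

  ∣touched∣≤ρ+numColours*d : (K : VSubset n q) → ∣ touched K ∣ ≤ ρ + numColours colour K * d
  ∣touched∣≤ρ+numColours*d K = ≤-trans
    (∣p∣≤e+∣p′∣*d offset d classColour level
      (λ i∈T → ∈-coloursOn⁺ colour K (proj₂ (∈-touched⁻ K i∈T)))
      level<d classColour-level-injective)
    (+-monoˡ-≤ _ (m⊓n≤m ρ (n ∸ m)))

ceilDiv≤⇒≤* : ∀ N d m → 1 ≤ d → ceilDiv N d ≤ m → N ≤ m * d
ceilDiv≤⇒≤* N (suc d′) m _ ceil≤m = +-cancelʳ-≤ d′ N (m * suc d′) (s≤s⁻¹ (begin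
  suc (N + d′)                              ≡⟨ cong (λ x → suc (x ∸ 1)) (+-suc N d′) ⟨
  suc X                                     ≡⟨ cong suc (m≡m%n+[m/n]*n X (suc d′)) ⟩
  suc (X % suc d′ + X / suc d′ * suc d′)    ≤⟨ +-monoˡ-≤ _ (m%n<n X (suc d′)) ⟩
  suc d′ + X / suc d′ * suc d′              ≤⟨ +-monoʳ-≤ (suc d′) (*-monoˡ-≤ (suc d′) ceil≤m) ⟩
  suc (d′ + m * suc d′)                     ≡⟨ cong suc (+-comm d′ _) ⟩
  suc (m * suc d′ + d′)                     ∎))
  where
  open ≤-Reasoning
  X : ℕ
  X = N + suc d′ ∸ 1

1+N≤[N∸A*[N/A]]+C*[N/A]⇒A<C : ∀ N A C .{{_ : NonZero A}} →
  suc N ≤ (N ∸ A * (N / A)) + C * (N / A) → A < C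
1+N≤[N∸A*[N/A]]+C*[N/A]⇒A<C N A C bound = ≰⇒> λ C≤A → 1+n≰n (begin
  suc N                             ≤⟨ bound ⟩
  (N ∸ A * (N / A)) + C * (N / A)   ≤⟨ +-monoʳ-≤ _ (*-monoˡ-≤ (N / A) C≤A) ⟩
  (N ∸ A * (N / A)) + A * (N / A)   ≡⟨ m∸n+n≡m (subst (_≤ N) (*-comm (N / A) A) (m/n*n≤m N A)) ⟩
  N                                 ∎)
  where open ≤-Reasoning

n*k+[s*k+t]∸k*s≡n*k+t : ∀ n k s t → n * k + (s * k + t) ∸ k * s ≡ n * k + t
n*k+[s*k+t]∸k*s≡n*k+t n k s t = begin
  n * k + (s * k + t) ∸ k * s   ≡⟨ cong (λ x → n * k + (x + t) ∸ k * s) (*-comm s k) ⟩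
  n * k + (k * s + t) ∸ k * s   ≡⟨ cong (_∸ k * s) (+-assoc (n * k) (k * s) t) ⟨
  n * k + k * s + t ∸ k * s     ≡⟨ cong (λ x → x + t ∸ k * s) (+-comm (n * k) (k * s)) ⟩
  k * s + n * k + t ∸ k * s     ≡⟨ cong (_∸ k * s) (+-assoc (k * s) (n * k) t) ⟩
  k * s + (n * k + t) ∸ k * s   ≡⟨ m+n∸m≡n (k * s) (n * k + t) ⟩
  n * k + t                     ∎
  where open ≡-Reasoning

inSpectrum-n≤m : ∀ {r σ α β} n q m k t .{{_ : NonZero n}} →
  n ≤ m → m ≤ n * q → m ≤ n * k + t → α ≤ s σ → β ≡ s σ * k + t → t < s σ →
  InSpectrum n r q σ α β m
inSpectrum-n≤m {σ = σ} n q m k t n≤m m≤n*q m≤n*k+t α≤s β≡ t<s =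
  colour , colour-surjective , λ K edge →
    let ∣T∣≡s = ∣touched∣≡s K edge
        t≤n = <⇒≤ (<-≤-trans t<s (subst (_≤ n) ∣T∣≡s (∣p∣≤n (touched K))))
    in ≤-trans α≤s (subst (_≤ numColours colour K) ∣T∣≡s
         (∣touched∣≤numColours colour colour-determines-class K))
     , subst (numColours colour K ≤_) (trans (cong (λ x → x * k + t) ∣T∣≡s) (sym β≡))
         (numColours≤∣touched∣*k+t k t m≤n*k+t t≤n K)
  where open ResidueColouring n q m n≤m m≤n*q

inSpectrum-m<n : ∀ {r σ β} n q m a .{{_ : NonZero m}} →
  m < n → 1 ≤ q → 2 + a ≤ s σ → s σ ≤ β →
  let d = (s σ ∸ 1) / suc a
      ρ = (s σ ∸ 1) ∸ suc a * d
  in ceilDiv (n ∸ ρ) d ≤ m → InSpectrum n r q σ (2 + a) β m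
inSpectrum-m<n {σ = σ} {β} n q m a m<n 1≤q α≤s s≤β ceil≤m =
  colour , colour-surjective (fromℕ< 1≤q) , λ K edge →
    let ∣T∣≡s = ∣touched∣≡s K edge
    in 1+N≤[N∸A*[N/A]]+C*[N/A]⇒A<C (s σ ∸ 1) (suc a) (numColours colour K)
         (subst (_≤ ρ + numColours colour K * d) (trans ∣T∣≡s (sym (m+[n∸m]≡n 1≤s)))
           (∣touched∣≤ρ+numColours*d K))
     , ≤-trans (numColours≤∣touched∣ classColour K) (subst (_≤ β) (sym ∣T∣≡s) s≤β)
  where
  d = (s σ ∸ 1) / suc a
  ρ = (s σ ∸ 1) ∸ suc a * d
  1≤s : 1 ≤ s σ
  1≤s = ≤-trans (s≤s z≤n) α≤s
  1≤d : 1 ≤ d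
  1≤d = m≥n⇒m/n>0 (∸-monoˡ-≤ 1 α≤s)
  open CyclicClassColouring n q m ρ d m<n 1≤d (ceilDiv≤⇒≤* (n ∸ ρ) d m 1≤d ceil≤m)

proposition3p2 : (r n q : ℕ) (σ : List ℕ) → 1 ≤ r → IsPartition r σ → 1 ≤ n → 1 ≤ q →
    (α β k t : ℕ) → 2 ≤ α → α ≤ s σ → s σ ≤ β →
    β ≡ s σ * k + t → 1 ≤ k → t < s σ →
    (m : ℕ) → 1 ≤ m →
    ceilDiv (n ∸ ((s σ ∸ 1) ∸ (α ∸ 1) * divℕ (s σ ∸ 1) (α ∸ 1))) (divℕ (s σ ∸ 1) (α ∸ 1)) ≤ m →
    m ≤ (n * q) ⊓ (n * k + β ∸ k * s σ) →
    InSpectrum n r q σ α β m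
proposition3p2 r n q σ _ _ 1≤n 1≤q (suc (suc a)) β k t (s≤s (s≤s _)) α≤s s≤β β≡ _ t<s
  m 1≤m ceil≤m m≤min with m <? n
... | yes m<n = inSpectrum-m<n {r} n q m a {{>-nonZero 1≤m}} m<n 1≤q α≤s s≤β ceil≤m
... | no m≮n = inSpectrum-n≤m {r} n q m k t {{>-nonZero 1≤n}}
  (≮⇒≥ m≮n) (≤-trans m≤min (m⊓n≤m _ _)) m≤n*k+t α≤s β≡ t<s
  where
  m≤n*k+t : m ≤ n * k + t
  m≤n*k+t = subst (m ≤_)
    (trans (cong (λ b → n * k + b ∸ k * s σ) β≡) (n*k+[s*k+t]∸k*s≡n*k+t n k (s σ) t))
    (≤-trans m≤min (m⊓n≤n _ _))
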